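{- Let $\mathbf{r}$ be such that $-\mathbf{r}\in\mathbb{N}^4$. Then the fourth characteristic ideal of $C_4^{\mathbf{r}}$ is not trivial; moreover $A_4(C_4^{\mathbf{r}},t)\subseteq\langle t+1,3\rangle$.
   Context: For a simple graph $G$ on $n$ vertices, $A_k(G,t)$ is the ideal of $\mathbb{Z}[t]$ generated by the $k\times k$ minors of $tI_n-A(G)$, where $A(G)$ is the adjacency matrix; it is trivial if it equals $\mathbb{Z}[t]$. $\mathbb{N}$ denotes the positive integers. For $-\mathbf{r}=(a_1,a_2,a_3,a_4)\in\mathbb{N}^4$, $C_4^{\mathbf{r}}$ is the graph obtained from the 4-cycle $v_1v_2v_3v_4$ by replacing each $v_i$ by a clique of size $a_i$, two vertices in different cliques being adjacent iff the corresponding cycle vertices are adjacent. -}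

module Defs where

open import Data.Nat as ℕ using (ℕ; zero; suc; _<ᵇ_; _≡ᵇ_)
open import Data.Integer as ℤ using (ℤ; +_; -[1+_])
open import Data.List using (List; []; _∷_; map)
open import Data.Fin using (Fin; zero; suc; toℕ; punchIn; _<_)
open import Data.Product using (Σ; _×_; _,_)
open import Data.Bool using (Bool; true; false; if_then_else_; _∧_; _∨_; not)
open import Relation.Binary.PropositionalEquality using (_≡_)

-- Polynomials in ℤ[t] as coefficient lists (constant term first),
-- with equality meaning equality of all coefficients.

Poly : Set
Poly = List ℤ

_+ₚ_ : Poly → Poly → Poly
[] +ₚ q = q
(x ∷ p) +ₚ [] = x ∷ p
(x ∷ p) +ₚ (y ∷ q) = (x ℤ.+ y) ∷ (p +ₚ q)

scaleₚ : ℤ → Poly → Poly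
scaleₚ c = map (c ℤ.*_)

_*ₚ_ : Poly → Poly → Poly
[] *ₚ q = []
(x ∷ p) *ₚ q = scaleₚ x q +ₚ (+ 0 ∷ (p *ₚ q))

-ₚ_ : Poly → Poly
-ₚ p = scaleₚ -[1+ 0 ] p

0ₚ 1ₚ tₚ : Poly
0ₚ = []
1ₚ = + 1 ∷ []
tₚ = + 0 ∷ + 1 ∷ []

constₚ : ℤ → Poly
constₚ c = c ∷ []

coeff : Poly → ℕ → ℤ
coeff [] _ = + 0
coeff (x ∷ p) zero = x
coeff (x ∷ p) (suc i) = coeff p i

infix 4 _≈ₚ_
_≈ₚ_ : Poly → Poly → Set
p ≈ₚ q = ∀ i → coeff p i ≡ coeff q i

sumFinₚ : ∀ {m} → (Fin m → Poly) → Poly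
sumFinₚ {zero} f = 0ₚ
sumFinₚ {suc m} f = f zero +ₚ sumFinₚ (λ i → f (suc i))

sumListₚ : List Poly → Poly
sumListₚ [] = 0ₚ
sumListₚ (p ∷ ps) = p +ₚ sumListₚ ps

sign : ∀ {m} → Fin m → ℤ
sign j = if isEven (toℕ j) then + 1 else -[1+ 0 ]
  where
  isEven : ℕ → Bool
  isEven zero = true
  isEven (suc n) = not (isEven n)

det : ∀ {n} → (Fin n → Fin n → Poly) → Poly
det {zero} M = 1ₚ
det {suc n} M =
  sumFinₚ (λ j → scaleₚ (sign j) (M zero j *ₚ det (λ r c → M (suc r) (punchIn j c))))

StrictlyIncreasing : ∀ {k n} → (Fin k → Fin n) → Set
StrictlyIncreasing f = ∀ i j → i < j → f i < f j

minor : ∀ {k n} → (Fin n → Fin n → Poly) → (Fin k → Fin n) → (Fin k → Fin n) → Poly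
minor M rows cols = det (λ i j → M (rows i) (cols j))

record MinorTerm (k n : ℕ) : Set where
  field
    coef : Poly
    rows : Fin k → Fin n
    cols : Fin k → Fin n
    rows-inc : StrictlyIncreasing rows
    cols-inc : StrictlyIncreasing cols

termValue : ∀ {k n} → (Fin n → Fin n → Poly) → MinorTerm k n → Poly
termValue M τ = MinorTerm.coef τ *ₚ minor M (MinorTerm.rows τ) (MinorTerm.cols τ)

MinorIdeal : (k : ℕ) → ∀ {n} → (Fin n → Fin n → Poly) → Poly → Set
MinorIdeal k {n} M p = Σ (List (MinorTerm k n)) λ ts → p ≈ₚ sumListₚ (map (termValue M) ts)

Trivial : (Poly → Set) → Set
Trivial I = ∀ p → I p

Ideal-t+1-3 : Poly → Set
Ideal-t+1-3 p = Σ Poly λ f → Σ Poly λ g →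
  p ≈ₚ ((tₚ +ₚ 1ₚ) *ₚ f) +ₚ (constₚ (+ 3) *ₚ g)

charMatrix : ∀ {n} → (Fin n → Fin n → ℤ) → Fin n → Fin n → Poly
charMatrix A i j =
  (if toℕ i ≡ᵇ toℕ j then tₚ else 0ₚ) +ₚ constₚ (ℤ.- A i j)

charIdeal : (k : ℕ) → ∀ {n} → (Fin n → Fin n → ℤ) → Poly → Set
charIdeal k A = MinorIdeal k (charMatrix A)

-- The graph C₄^r, r = -(a₁,a₂,a₃,a₄).  Vertices 0 … a₁+a₂+a₃+a₄-1;
-- the first a₁ form the clique replacing v₁, the next a₂ that of v₂, etc.

blockOf : ℕ → ℕ → ℕ → ℕ → Fin 4
blockOf a₁ a₂ a₃ v =
  if v <ᵇ a₁ then zero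
  else if v <ᵇ a₁ ℕ.+ a₂ then suc zero
  else if v <ᵇ a₁ ℕ.+ a₂ ℕ.+ a₃ then suc (suc zero)
  else suc (suc (suc zero))

cycleAdj : Fin 4 → Fin 4 → Bool
cycleAdj x y =
  let m = toℕ x ; n = toℕ y in
  (suc m ≡ᵇ n) ∨ (suc n ≡ᵇ m) ∨ ((m ≡ᵇ 0) ∧ (n ≡ᵇ 3)) ∨ ((m ≡ᵇ 3) ∧ (n ≡ᵇ 0))

C4r-adj : (a₁ a₂ a₃ a₄ : ℕ) → Fin (a₁ ℕ.+ a₂ ℕ.+ a₃ ℕ.+ a₄) → Fin (a₁ ℕ.+ a₂ ℕ.+ a₃ ℕ.+ a₄) → ℤ
C4r-adj a₁ a₂ a₃ a₄ u v =
  let bu = blockOf a₁ a₂ a₃ (toℕ u) ; bv = blockOf a₁ a₂ a₃ (toℕ v) in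
  if toℕ u ≡ᵇ toℕ v then + 0
  else if (toℕ bu ≡ᵇ toℕ bv) ∨ cycleAdj bu bv then + 1
  else + 0

-- Evaluation at t = −1 is a ring map ℤ[t] → ℤ, and since dividing p by t + 1 leaves the
-- constant p(−1), a polynomial lies in ⟨t + 1, 3⟩ exactly when 3 ∣ p(−1).  At t = −1 the
-- characteristic matrix of C₄^r becomes −(A + I), whose (u, v) entry depends only on the
-- cliques containing u and v: it is the entry of the closed adjacency matrix B of C₄ at those
-- cliques.  A 4×4 minor of it with increasing rows and columns is therefore the determinant of
-- −B with rows and columns repeated in nondecreasing order, which is 0 or ±det B = ∓3; a finite
-- check confirms this.  So A₄(C₄^r, t) ⊆ ⟨t + 1, 3⟩, and the inclusion is proper since 3 ∤ 1.
module Submission where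

open import Defs
open import Data.Nat using (ℕ; _≤_)
open import Data.Product using (_×_)
open import Relation.Nullary using (¬_)

open import Data.Bool using (Bool; true; false; if_then_else_; _∨_; T)
open import Data.Empty using (⊥-elim)
open import Data.Fin using (Fin; zero; suc; toℕ; punchIn; inject₁)
open import Data.Fin.Properties as Fin using (all?; ≤̄⇒inject₁<)
open import Data.Integer using (ℤ; +_; _+_; _-_; _*_; -_)
open import Data.Integer.Divisibility.Signed using (_∣_; divides; _∣?_; ∣m∣n⇒∣m+n; ∣n⇒∣m*n; ∣m⇒∣m*n)
open import Data.Integer.Properties using (+-identityˡ; +-identityʳ; *-zeroˡ; *-zeroʳ; *-identityˡ; *-comm)
open import Data.Integer.Tactic.RingSolver using (solve-∀)
open import Data.List using ([]; _∷_; map)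
open import Data.Nat as ℕ using (zero; suc; z≤n; s≤s; _<ᵇ_)
open import Data.Nat.Properties using (<ᵇ⇒<; <⇒<ᵇ; ≤-refl; ≤-<-trans; <⇒≤; ≡ᵇ⇒≡)
open import Data.Product using (_,_)
open import Data.Unit using (tt)
open import Function using (_∘_)
open import Relation.Binary.PropositionalEquality using (_≡_; refl; sym; trans; cong; cong₂; subst; subst₂; module ≡-Reasoning)
open import Relation.Nullary.Decidable using (Dec; toWitness; toWitnessFalse; _→-dec_)

open ≡-Reasoning

ev₋₁ : Poly → ℤ
ev₋₁ [] = + 0
ev₋₁ (x ∷ p) = x - ev₋₁ p

ev₋₁-+ : ∀ p q → ev₋₁ (p +ₚ q) ≡ ev₋₁ p + ev₋₁ q
ev₋₁-+ [] q = sym (+-identityˡ _)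
ev₋₁-+ (x ∷ p) [] = sym (+-identityʳ _)
ev₋₁-+ (x ∷ p) (y ∷ q) = begin
  (x + y) - ev₋₁ (p +ₚ q)        ≡⟨ cong (_-_ (x + y)) (ev₋₁-+ p q) ⟩
  (x + y) - (ev₋₁ p + ev₋₁ q)  ≡⟨ lemma x y (ev₋₁ p) (ev₋₁ q) ⟩
  (x - ev₋₁ p) + (y - ev₋₁ q)  ∎
  where
  lemma : ∀ x y a b → (x + y) - (a + b) ≡ (x - a) + (y - b)
  lemma = solve-∀

ev₋₁-scale : ∀ c p → ev₋₁ (scaleₚ c p) ≡ c * ev₋₁ p
ev₋₁-scale c [] = sym (*-zeroʳ c)
ev₋₁-scale c (x ∷ p) = begin
  c * x - ev₋₁ (scaleₚ c p)  ≡⟨ cong (_-_ (c * x)) (ev₋₁-scale c p) ⟩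
  c * x - c * ev₋₁ p       ≡⟨ lemma c x (ev₋₁ p) ⟩
  c * (x - ev₋₁ p)           ∎
  where
  lemma : ∀ c x a → c * x - c * a ≡ c * (x - a)
  lemma = solve-∀

ev₋₁-* : ∀ p q → ev₋₁ (p *ₚ q) ≡ ev₋₁ p * ev₋₁ q
ev₋₁-* [] q = sym (*-zeroˡ (ev₋₁ q))
ev₋₁-* (x ∷ p) q = begin
  ev₋₁ (scaleₚ x q +ₚ (+ 0 ∷ (p *ₚ q)))          ≡⟨ ev₋₁-+ (scaleₚ x q) (+ 0 ∷ (p *ₚ q)) ⟩
  ev₋₁ (scaleₚ x q) + (+ 0 - ev₋₁ (p *ₚ q))  ≡⟨ cong₂ (λ u v → u + (+ 0 - v)) (ev₋₁-scale x q) (ev₋₁-* p q) ⟩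
  x * ev₋₁ q + (+ 0 - ev₋₁ p * ev₋₁ q)   ≡⟨ lemma x (ev₋₁ p) (ev₋₁ q) ⟩
  (x - ev₋₁ p) * ev₋₁ q                      ∎
  where
  lemma : ∀ x a b → x * b + (+ 0 - a * b) ≡ (x - a) * b
  lemma = solve-∀

ev₋₁-cong : ∀ p q → p ≈ₚ q → ev₋₁ p ≡ ev₋₁ q
ev₋₁-cong [] [] p≈q = refl
ev₋₁-cong [] (y ∷ q) p≈q
  rewrite sym (p≈q zero) | sym (ev₋₁-cong [] q (p≈q ∘ suc)) = refl
ev₋₁-cong (x ∷ p) [] p≈q
  rewrite p≈q zero | ev₋₁-cong p [] (p≈q ∘ suc) = refl
ev₋₁-cong (x ∷ p) (y ∷ q) p≈q = cong₂ _-_ (p≈q zero) (ev₋₁-cong p q (p≈q ∘ suc))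

sumFinℤ : ∀ {m} → (Fin m → ℤ) → ℤ
sumFinℤ {zero} f = + 0
sumFinℤ {suc m} f = f zero + sumFinℤ (f ∘ suc)

sumFinℤ-cong : ∀ {m} {f g : Fin m → ℤ} → (∀ i → f i ≡ g i) → sumFinℤ f ≡ sumFinℤ g
sumFinℤ-cong {zero} f≡g = refl
sumFinℤ-cong {suc m} f≡g = cong₂ _+_ (f≡g zero) (sumFinℤ-cong (f≡g ∘ suc))

detℤ : ∀ {n} → (Fin n → Fin n → ℤ) → ℤ
detℤ {zero} M = + 1
detℤ {suc n} M = sumFinℤ (λ j → sign j * (M zero j * detℤ (λ r c → M (suc r) (punchIn j c))))

detℤ-cong : ∀ {n} {M N : Fin n → Fin n → ℤ} → (∀ i j → M i j ≡ N i j) → detℤ M ≡ detℤ N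
detℤ-cong {zero} M≡N = refl
detℤ-cong {suc n} M≡N = sumFinℤ-cong λ j →
  cong₂ (λ u v → sign j * (u * v)) (M≡N zero j) (detℤ-cong (λ r c → M≡N (suc r) (punchIn j c)))

ev₋₁-sumFin : ∀ {m} (f : Fin m → Poly) → ev₋₁ (sumFinₚ f) ≡ sumFinℤ (ev₋₁ ∘ f)
ev₋₁-sumFin {zero} f = refl
ev₋₁-sumFin {suc m} f = trans (ev₋₁-+ (f zero) (sumFinₚ (f ∘ suc)))
  (cong (_+_ (ev₋₁ (f zero))) (ev₋₁-sumFin (f ∘ suc)))

ev₋₁-det : ∀ {n} (M : Fin n → Fin n → Poly) → ev₋₁ (det M) ≡ detℤ (λ i j → ev₋₁ (M i j))
ev₋₁-det {zero} M = refl
ev₋₁-det {suc n} M = trans (ev₋₁-sumFin (λ j → scaleₚ (sign j) (M zero j *ₚ det (λ r c → M (suc r) (punchIn j c)))))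
  (sumFinℤ-cong expansionTerm)
  where
  expansionTerm : ∀ j → ev₋₁ (scaleₚ (sign j) (M zero j *ₚ det (λ r c → M (suc r) (punchIn j c))))
                      ≡ sign j * (ev₋₁ (M zero j) * detℤ (λ r c → ev₋₁ (M (suc r) (punchIn j c))))
  expansionTerm j = begin
    ev₋₁ (scaleₚ (sign j) (M zero j *ₚ minorⱼ))  ≡⟨ ev₋₁-scale (sign j) (M zero j *ₚ minorⱼ) ⟩
    sign j * ev₋₁ (M zero j *ₚ minorⱼ)          ≡⟨ cong (_*_ (sign j)) (ev₋₁-* (M zero j) minorⱼ) ⟩
    sign j * (ev₋₁ (M zero j) * ev₋₁ minorⱼ)  ≡⟨ cong (λ z → sign j * (ev₋₁ (M zero j) * z)) (ev₋₁-det (λ r c → M (suc r) (punchIn j c))) ⟩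
    sign j * (ev₋₁ (M zero j) * detℤ (λ r c → ev₋₁ (M (suc r) (punchIn j c)))) ∎
    where minorⱼ = det (λ r c → M (suc r) (punchIn j c))

minorIdeal⇒∣ev₋₁ : ∀ {k n} (M : Fin n → Fin n → Poly) {d : ℤ} →
  (∀ rows cols → StrictlyIncreasing rows → StrictlyIncreasing cols → d ∣ ev₋₁ (minor M rows cols)) →
  ∀ p → MinorIdeal k M p → d ∣ ev₋₁ p
minorIdeal⇒∣ev₋₁ {k} {n} M {d} minors∣ p (ts , p≈) =
  subst (d ∣_) (sym (ev₋₁-cong p (sumListₚ (map (termValue M) ts)) p≈)) (combination∣ ts)
  where
  combination∣ : ∀ ts → d ∣ ev₋₁ (sumListₚ (map (termValue M) ts))
  combination∣ [] = divides (+ 0) refl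
  combination∣ (τ ∷ ts) = subst (d ∣_) (sym (ev₋₁-+ (termValue M τ) _)) (∣m∣n⇒∣m+n term∣ (combination∣ ts))
    where
    open MinorTerm τ
    term∣ : d ∣ ev₋₁ (termValue M τ)
    term∣ = subst (d ∣_) (sym (ev₋₁-* coef _)) (∣n⇒∣m*n (ev₋₁ coef) (minors∣ rows cols rows-inc cols-inc))

coeff-+ₚ : ∀ p q i → coeff (p +ₚ q) i ≡ coeff p i + coeff q i
coeff-+ₚ [] q i = sym (+-identityˡ _)
coeff-+ₚ (x ∷ p) [] i = sym (+-identityʳ _)
coeff-+ₚ (x ∷ p) (y ∷ q) zero = refl
coeff-+ₚ (x ∷ p) (y ∷ q) (suc i) = coeff-+ₚ p q i

coeff-scaleₚ : ∀ c p i → coeff (scaleₚ c p) i ≡ c * coeff p i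
coeff-scaleₚ c [] i = sym (*-zeroʳ c)
coeff-scaleₚ c (x ∷ p) zero = refl
coeff-scaleₚ c (x ∷ p) (suc i) = coeff-scaleₚ c p i

coeff-[t+1]* : ∀ f i → coeff ((tₚ +ₚ 1ₚ) *ₚ f) i ≡ coeff f i + coeff (+ 0 ∷ f) i
coeff-[t+1]* f i = begin
  coeff (scaleₚ (+ 1) f +ₚ (+ 0 ∷ (scaleₚ (+ 1) f +ₚ (+ 0 ∷ [])))) i
    ≡⟨ coeff-+ₚ (scaleₚ (+ 1) f) _ i ⟩
  coeff (scaleₚ (+ 1) f) i + coeff (+ 0 ∷ (scaleₚ (+ 1) f +ₚ (+ 0 ∷ []))) i
    ≡⟨ cong₂ _+_ (coeff-scale1 i) (shifted i) ⟩
  coeff f i + coeff (+ 0 ∷ f) i ∎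
  where
  coeff-scale1 : ∀ i → coeff (scaleₚ (+ 1) f) i ≡ coeff f i
  coeff-scale1 i = trans (coeff-scaleₚ (+ 1) f i) (*-identityˡ _)
  shifted : ∀ i → coeff (+ 0 ∷ (scaleₚ (+ 1) f +ₚ (+ 0 ∷ []))) i ≡ coeff (+ 0 ∷ f) i
  shifted zero = refl
  shifted (suc i) = begin
    coeff (scaleₚ (+ 1) f +ₚ (+ 0 ∷ [])) i          ≡⟨ coeff-+ₚ (scaleₚ (+ 1) f) _ i ⟩
    coeff (scaleₚ (+ 1) f) i + coeff (+ 0 ∷ []) i ≡⟨ cong₂ _+_ (coeff-scale1 i) (coeff-0 i) ⟩
    coeff f i + + 0                               ≡⟨ +-identityʳ _ ⟩
    coeff f i                                       ∎
    where
    coeff-0 : ∀ i → coeff (+ 0 ∷ []) i ≡ + 0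
    coeff-0 zero = refl
    coeff-0 (suc i) = refl

quotient-t+1 : Poly → Poly
quotient-t+1 [] = []
quotient-t+1 (x ∷ q) = ev₋₁ q ∷ quotient-t+1 q

division-by-t+1 : ∀ p → p ≈ₚ ((tₚ +ₚ 1ₚ) *ₚ quotient-t+1 p) +ₚ constₚ (ev₋₁ p)
division-by-t+1 p i = begin
  coeff p i
    ≡⟨ coefficientwise p i ⟩
  coeff (quotient-t+1 p) i + coeff (+ 0 ∷ quotient-t+1 p) i + coeff (constₚ (ev₋₁ p)) i
    ≡⟨ cong (_+ coeff (constₚ (ev₋₁ p)) i) (sym (coeff-[t+1]* (quotient-t+1 p) i)) ⟩
  coeff ((tₚ +ₚ 1ₚ) *ₚ quotient-t+1 p) i + coeff (constₚ (ev₋₁ p)) i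
    ≡⟨ sym (coeff-+ₚ ((tₚ +ₚ 1ₚ) *ₚ quotient-t+1 p) _ i) ⟩
  coeff (((tₚ +ₚ 1ₚ) *ₚ quotient-t+1 p) +ₚ constₚ (ev₋₁ p)) i ∎
  where
  coefficientwise : ∀ p i →
    coeff p i ≡ coeff (quotient-t+1 p) i + coeff (+ 0 ∷ quotient-t+1 p) i + coeff (constₚ (ev₋₁ p)) i
  coefficientwise [] zero = refl
  coefficientwise [] (suc i) = refl
  coefficientwise (x ∷ q) zero = lemma x (ev₋₁ q)
    where
    lemma : ∀ x a → x ≡ a + + 0 + (x - a)
    lemma = solve-∀
  coefficientwise (x ∷ q) (suc zero) = trans (coefficientwise q zero) (lemma (coeff (quotient-t+1 q) zero) (ev₋₁ q))
    where
    lemma : ∀ a b → a + + 0 + b ≡ a + b + + 0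
    lemma = solve-∀
  coefficientwise (x ∷ q) (suc (suc i)) = coefficientwise q (suc i)

Ideal-t+1-3⇒3∣ev₋₁ : ∀ p → Ideal-t+1-3 p → + 3 ∣ ev₋₁ p
Ideal-t+1-3⇒3∣ev₋₁ p (f , g , p≈) = subst (+ 3 ∣_) (sym ev₋₁-p)
  (∣m∣n⇒∣m+n (∣m⇒∣m*n (ev₋₁ f) (divides (+ 0) refl)) (∣m⇒∣m*n (ev₋₁ g) (divides (+ 1) refl)))
  where
  ev₋₁-p : ev₋₁ p ≡ ev₋₁ (tₚ +ₚ 1ₚ) * ev₋₁ f + ev₋₁ (constₚ (+ 3)) * ev₋₁ g
  ev₋₁-p = begin
    ev₋₁ p                                                   ≡⟨ ev₋₁-cong p (((tₚ +ₚ 1ₚ) *ₚ f) +ₚ (constₚ (+ 3) *ₚ g)) p≈ ⟩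
    ev₋₁ (((tₚ +ₚ 1ₚ) *ₚ f) +ₚ (constₚ (+ 3) *ₚ g))          ≡⟨ ev₋₁-+ ((tₚ +ₚ 1ₚ) *ₚ f) (constₚ (+ 3) *ₚ g) ⟩
    ev₋₁ ((tₚ +ₚ 1ₚ) *ₚ f) + ev₋₁ (constₚ (+ 3) *ₚ g)        ≡⟨ cong₂ _+_ (ev₋₁-* (tₚ +ₚ 1ₚ) f) (ev₋₁-* (constₚ (+ 3)) g) ⟩
    ev₋₁ (tₚ +ₚ 1ₚ) * ev₋₁ f + ev₋₁ (constₚ (+ 3)) * ev₋₁ g ∎

3∣ev₋₁⇒Ideal-t+1-3 : ∀ p → + 3 ∣ ev₋₁ p → Ideal-t+1-3 p
3∣ev₋₁⇒Ideal-t+1-3 p (divides k ev≡k*3) = quotient-t+1 p , constₚ k , λ i → begin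
  coeff p i
    ≡⟨ division-by-t+1 p i ⟩
  coeff ([t+1]*q +ₚ constₚ (ev₋₁ p)) i
    ≡⟨ coeff-+ₚ [t+1]*q (constₚ (ev₋₁ p)) i ⟩
  coeff [t+1]*q i + coeff (constₚ (ev₋₁ p)) i
    ≡⟨ cong (_+_ (coeff [t+1]*q i)) (remainder i) ⟩
  coeff [t+1]*q i + coeff (constₚ (+ 3) *ₚ constₚ k) i
    ≡⟨ sym (coeff-+ₚ [t+1]*q (constₚ (+ 3) *ₚ constₚ k) i) ⟩
  coeff ([t+1]*q +ₚ (constₚ (+ 3) *ₚ constₚ k)) i ∎
  where
  [t+1]*q = (tₚ +ₚ 1ₚ) *ₚ quotient-t+1 p
  remainder : constₚ (ev₋₁ p) ≈ₚ constₚ (+ 3) *ₚ constₚ k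
  remainder zero = trans ev≡k*3 (trans (*-comm k (+ 3)) (sym (+-identityʳ _)))
  remainder (suc i) = refl

1ₚ∉⟨t+1,3⟩ : ¬ Ideal-t+1-3 1ₚ
1ₚ∉⟨t+1,3⟩ 1ₚ∈ = toWitnessFalse {a? = + 3 ∣? + 1} tt (Ideal-t+1-3⇒3∣ev₋₁ 1ₚ 1ₚ∈)

NonDecreasing : ∀ {m n} → (Fin (suc m) → Fin n) → Set
NonDecreasing {m} X = ∀ (i : Fin m) → toℕ (X (inject₁ i)) ≤ toℕ (X (suc i))

nonDecreasing? : ∀ {m n} (X : Fin (suc m) → Fin n) → Dec (NonDecreasing X)
nonDecreasing? X = all? λ i → toℕ (X (inject₁ i)) ℕ.≤? toℕ (X (suc i))

nonDecreasing-cong : ∀ {m n} {X Y : Fin (suc m) → Fin n} → (∀ i → X i ≡ Y i) → NonDecreasing X → NonDecreasing Y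
nonDecreasing-cong X≡Y X↑ i = subst₂ (λ x y → toℕ x ≤ toℕ y) (X≡Y (inject₁ i)) (X≡Y (suc i)) (X↑ i)

nonDecreasing-∘ : ∀ {m n k} {f : Fin (suc m) → Fin n} {g : Fin n → Fin k} →
  StrictlyIncreasing f → (∀ u v → toℕ u ≤ toℕ v → toℕ (g u) ≤ toℕ (g v)) → NonDecreasing (g ∘ f)
nonDecreasing-∘ f-inc g-mono i = g-mono _ _ (<⇒≤ (f-inc (inject₁ i) (suc i) (≤̄⇒inject₁< Fin.≤-refl)))

firstTrue : Bool → Bool → Bool → Fin 4
firstTrue b₁ b₂ b₃ = if b₁ then zero else if b₂ then suc zero else if b₃ then suc (suc zero) else suc (suc (suc zero))

firstTrue-antitone : ∀ b₁ b₂ b₃ c₁ c₂ c₃ → (T c₁ → T b₁) → (T c₂ → T b₂) → (T c₃ → T b₃) →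
  toℕ (firstTrue b₁ b₂ b₃) ≤ toℕ (firstTrue c₁ c₂ c₃)
firstTrue-antitone true _ _ _ _ _ _ _ _ = z≤n
firstTrue-antitone false _ _ true _ _ c₁⇒b₁ _ _ = ⊥-elim (c₁⇒b₁ tt)
firstTrue-antitone false true _ false true _ _ _ _ = ≤-refl
firstTrue-antitone false true _ false false true _ _ _ = s≤s z≤n
firstTrue-antitone false true _ false false false _ _ _ = s≤s z≤n
firstTrue-antitone false false _ false true _ _ c₂⇒b₂ _ = ⊥-elim (c₂⇒b₂ tt)
firstTrue-antitone false false true false false true _ _ _ = ≤-refl
firstTrue-antitone false false true false false false _ _ _ = s≤s (s≤s z≤n)
firstTrue-antitone false false false false false true _ _ c₃⇒b₃ = ⊥-elim (c₃⇒b₃ tt)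
firstTrue-antitone false false false false false false _ _ _ = ≤-refl

blockOf-mono : ∀ a₁ a₂ a₃ {v w} → v ≤ w → toℕ (blockOf a₁ a₂ a₃ v) ≤ toℕ (blockOf a₁ a₂ a₃ w)
blockOf-mono a₁ a₂ a₃ {v} {w} v≤w = firstTrue-antitone _ _ _ _ _ _
  (below a₁) (below (a₁ ℕ.+ a₂)) (below (a₁ ℕ.+ a₂ ℕ.+ a₃))
  where
  below : ∀ k → T (w <ᵇ k) → T (v <ᵇ k)
  below k w<k = <⇒<ᵇ (≤-<-trans v≤w (<ᵇ⇒< w k w<k))

closedAdjC₄ : Fin 4 → Fin 4 → ℤ
closedAdjC₄ x y = if (toℕ x ℕ.≡ᵇ toℕ y) ∨ cycleAdj x y then + 1 else + 0

closedAdjC₄-refl : ∀ x → closedAdjC₄ x x ≡ + 1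
closedAdjC₄-refl zero = refl
closedAdjC₄-refl (suc zero) = refl
closedAdjC₄-refl (suc (suc zero)) = refl
closedAdjC₄-refl (suc (suc (suc zero))) = refl

fromValues₄ : {A : Set} → A → A → A → A → Fin 4 → A
fromValues₄ a b c d zero = a
fromValues₄ a b c d (suc zero) = b
fromValues₄ a b c d (suc (suc zero)) = c
fromValues₄ a b c d (suc (suc (suc zero))) = d

fromValues₄-values : {A : Set} (X : Fin 4 → A) →
  ∀ i → fromValues₄ (X zero) (X (suc zero)) (X (suc (suc zero))) (X (suc (suc (suc zero)))) i ≡ X i
fromValues₄-values X zero = refl
fromValues₄-values X (suc zero) = refl
fromValues₄-values X (suc (suc zero)) = refl
fromValues₄-values X (suc (suc (suc zero))) = refl

3∣det-closedAdjC₄-blockPattern : ∀ (X Y : Fin 4 → Fin 4) → NonDecreasing X → NonDecreasing Y →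
  + 3 ∣ detℤ (λ i j → - closedAdjC₄ (X i) (Y j))
3∣det-closedAdjC₄-blockPattern X Y X↑ Y↑ =
  subst (+ 3 ∣_) (detℤ-cong {M = blockPattern (listed X) (listed Y)} {N = blockPattern X Y}
                             λ i j → cong₂ (λ x y → - closedAdjC₄ x y) (fromValues₄-values X i) (fromValues₄-values Y j))
    (exhaustive (X zero) (X (suc zero)) (X (suc (suc zero))) (X (suc (suc (suc zero))))
                (nonDecreasing-cong (sym ∘ fromValues₄-values X) X↑)
                (Y zero) (Y (suc zero)) (Y (suc (suc zero))) (Y (suc (suc (suc zero))))
                (nonDecreasing-cong (sym ∘ fromValues₄-values Y) Y↑))
  where
  listed : (Fin 4 → Fin 4) → Fin 4 → Fin 4
  listed X = fromValues₄ (X zero) (X (suc zero)) (X (suc (suc zero))) (X (suc (suc (suc zero))))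
  blockPattern : (Fin 4 → Fin 4) → (Fin 4 → Fin 4) → Fin 4 → Fin 4 → ℤ
  blockPattern X Y i j = - closedAdjC₄ (X i) (Y j)
  exhaustive : ∀ a b c d → NonDecreasing (fromValues₄ a b c d) →
               ∀ e f g h → NonDecreasing (fromValues₄ e f g h) →
               + 3 ∣ detℤ (λ i j → - closedAdjC₄ (fromValues₄ a b c d i) (fromValues₄ e f g h j))
  exhaustive = toWitness
    {a? = all? λ a → all? λ b → all? λ c → all? λ d → nonDecreasing? (fromValues₄ a b c d) →-dec
          all? λ e → all? λ f → all? λ g → all? λ h → nonDecreasing? (fromValues₄ e f g h) →-dec
          (+ 3 ∣? detℤ (λ i j → - closedAdjC₄ (fromValues₄ a b c d i) (fromValues₄ e f g h j)))} _

module _ (a₁ a₂ a₃ a₄ : ℕ) where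
  private
    A = C4r-adj a₁ a₂ a₃ a₄
    clique : Fin (a₁ ℕ.+ a₂ ℕ.+ a₃ ℕ.+ a₄) → Fin 4
    clique u = blockOf a₁ a₂ a₃ (toℕ u)

  ev₋₁-charMatrix-C4r : ∀ u v → ev₋₁ (charMatrix A u v) ≡ - closedAdjC₄ (clique u) (clique v)
  ev₋₁-charMatrix-C4r u v with toℕ u ℕ.≡ᵇ toℕ v in u≡ᵇv
  ... | true rewrite ≡ᵇ⇒≡ (toℕ u) (toℕ v) (subst T (sym u≡ᵇv) tt) | closedAdjC₄-refl (clique v) = refl
  ... | false = +-identityʳ _

  3∣ev₋₁-minor-C4r : ∀ rows cols → StrictlyIncreasing rows → StrictlyIncreasing cols →
    + 3 ∣ ev₋₁ (minor (charMatrix A) rows cols)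
  3∣ev₋₁-minor-C4r rows cols rows-inc cols-inc = subst (+ 3 ∣_) (sym ev₋₁-minor)
    (3∣det-closedAdjC₄-blockPattern (clique ∘ rows) (clique ∘ cols)
      (nonDecreasing-∘ rows-inc clique-mono) (nonDecreasing-∘ cols-inc clique-mono))
    where
    clique-mono : ∀ u v → toℕ u ≤ toℕ v → toℕ (clique u) ≤ toℕ (clique v)
    clique-mono _ _ = blockOf-mono a₁ a₂ a₃
    ev₋₁-minor : ev₋₁ (minor (charMatrix A) rows cols) ≡ detℤ (λ i j → - closedAdjC₄ (clique (rows i)) (clique (cols j)))
    ev₋₁-minor = trans (ev₋₁-det (λ i j → charMatrix A (rows i) (cols j)))
                       (detℤ-cong λ i j → ev₋₁-charMatrix-C4r (rows i) (cols j))

mainTheorem10 : (a₁ a₂ a₃ a₄ : ℕ) → 1 ≤ a₁ → 1 ≤ a₂ → 1 ≤ a₃ → 1 ≤ a₄ →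
    ¬ Trivial (charIdeal 4 (C4r-adj a₁ a₂ a₃ a₄))
    × (∀ p → charIdeal 4 (C4r-adj a₁ a₂ a₃ a₄) p → Ideal-t+1-3 p)
mainTheorem10 a₁ a₂ a₃ a₄ _ _ _ _ = nontrivial , A₄⊆⟨t+1,3⟩
  where
  A₄⊆⟨t+1,3⟩ : ∀ p → charIdeal 4 (C4r-adj a₁ a₂ a₃ a₄) p → Ideal-t+1-3 p
  A₄⊆⟨t+1,3⟩ p p∈A₄ = 3∣ev₋₁⇒Ideal-t+1-3 p
    (minorIdeal⇒∣ev₋₁ (charMatrix (C4r-adj a₁ a₂ a₃ a₄)) (3∣ev₋₁-minor-C4r a₁ a₂ a₃ a₄) p p∈A₄)
  nontrivial : ¬ Trivial (charIdeal 4 (C4r-adj a₁ a₂ a₃ a₄))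
  nontrivial trivial = 1ₚ∉⟨t+1,3⟩ (A₄⊆⟨t+1,3⟩ 1ₚ (trivial 1ₚ))
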